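{- Let $\mathcal A$ be an alphabet containing at least two letters and let $v\in\mathcal A^*$. The epistandard morphism $\mu_v$ is strongly quasiperiodic on $\mathcal A$ if and only if $\mathrm{Alph}(v)=\mathcal A$. Moreover, when $\mathrm{Alph}(v)=\mathcal A$, $Pal(v)$ is a quasiperiod of $\mu_v(\mathbf w)$ for every infinite word $\mathbf w$ over $\mathcal A$.
   Context: $\mathrm{Alph}(u)$ is the set of letters of $u$. For $a\in\mathcal A$, $L_a$ is the morphism with $L_a(a)=a$, $L_a(b)=ab$ for $b\ne a$; for $v=x_1\cdots x_n$, $\mu_v=L_{x_1}\circ\cdots\circ L_{x_n}$ ($\mu_\varepsilon$ the identity), extended letterwise to infinite words. $Pal$: $Pal(\varepsilon)=\varepsilon$, $Pal(ux)$ is the shortest palindrome having $Pal(u)x$ as a prefix. A finite word $u$ is a quasiperiod of an infinite word $\mathbf w$ if there are words $p_n$ ($n\ge0$) with $p_0=\varepsilon$, $|p_n|<|p_{n+1}|\le|p_nu|$ and $p_nu$ a prefix of $\mathbf w$; $\mathbf w$ is quasiperiodic if it has a quasiperiod. A morphism $f$ on $\mathcal A$ is strongly quasiperiodic if $f(\mathbf w)$ is quasiperiodic for every infinite word $\mathbf w$ over $\mathcal A$. -}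

module Defs where

open import Data.Nat using (ℕ; zero; suc; _<_; _≤_)
open import Data.Fin using (Fin; fromℕ<)
open import Data.Fin.Properties using (_≟_)
open import Data.List using (List; []; _∷_; _++_; length; reverse; lookup; _∷ʳ_)
open import Data.List.NonEmpty as L⁺ using (List⁺; _∷_; concatMap)
open import Data.List.Membership.Propositional using (_∈_)
open import Data.Product using (Σ; ∃; _×_; _,_)
open import Relation.Binary.PropositionalEquality using (_≡_)
open import Relation.Nullary using (yes; no)

Word : ℕ → Set
Word n = List (Fin n)

InfWord : ℕ → Set
InfWord n = ℕ → Fin n

Morphism : ℕ → Set
Morphism n = Fin n → List⁺ (Fin n)

AlphIsAll : ∀ {n} → Word n → Set
AlphIsAll {n} u = (a : Fin n) → a ∈ u

L : ∀ {n} → Fin n → Morphism n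
L a b with a ≟ b
... | yes _ = a ∷ []
... | no  _ = a ∷ (b ∷ [])

_∘ᵐ_ : ∀ {n} → Morphism n → Morphism n → Morphism n
(g ∘ᵐ f) b = concatMap g (f b)

idᵐ : ∀ {n} → Morphism n
idᵐ b = b ∷ []

μ : ∀ {n} → Word n → Morphism n
μ []      = idᵐ
μ (x ∷ v) = L x ∘ᵐ μ v

-- image f(𝐰) = f(w₀) f(w₁) f(w₂) ⋯ of an infinite word under a non-erasing morphism
-- at cur s i : the i-th letter of  cur · f(s 0) · f(s 1) ⋯
at : ∀ {n} → Morphism n → List⁺ (Fin n) → InfWord n → ℕ → Fin n
at f (x ∷ xs)       s zero    = x
at f (x ∷ [])       s (suc i) = at f (f (s 0)) (λ k → s (suc k)) i
at f (x ∷ (y ∷ ys)) s (suc i) = at f (y ∷ ys) s i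

image : ∀ {n} → Morphism n → InfWord n → InfWord n
image f w = at f (f (w 0)) (λ k → w (suc k))

IsPrefix : ∀ {n} → Word n → InfWord n → Set
IsPrefix u w = ∀ i (i<|u| : i < length u) → lookup u (fromℕ< i<|u|) ≡ w i

IsQuasiperiod : ∀ {n} → Word n → InfWord n → Set
IsQuasiperiod {n} u w =
  Σ (ℕ → Word n) λ p →
    (p 0 ≡ []) ×
    (∀ k → (length (p k) < length (p (suc k)))
         × (length (p (suc k)) ≤ length (p k ++ u))
         × IsPrefix (p k ++ u) w)

Quasiperiodic : ∀ {n} → InfWord n → Set
Quasiperiodic {n} w = ∃ λ (u : Word n) → IsQuasiperiod u w

StronglyQuasiperiodic : ∀ {n} → Morphism n → Set
StronglyQuasiperiodic {n} f = (w : InfWord n) → Quasiperiodic (image f w)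

IsPrefixW : ∀ {n} → Word n → Word n → Set
IsPrefixW {n} u x = ∃ λ (t : Word n) → u ++ t ≡ x

IsPalindrome : ∀ {n} → Word n → Set
IsPalindrome u = reverse u ≡ u

ShortestPalWithPrefix : ∀ {n} → Word n → Word n → Set
ShortestPalWithPrefix {n} u q =
  IsPalindrome q × IsPrefixW u q ×
  ((r : Word n) → IsPalindrome r → IsPrefixW u r → length q ≤ length r)

-- PalOf v q  :⇔  q = Pal(v)   (the paper's recursive definition, as a relation)
data PalOf {n : ℕ} : Word n → Word n → Set where
  pal-ε : PalOf [] []
  pal-snoc : ∀ {u p q} (x : Fin n) → PalOf u p →
             ShortestPalWithPrefix (p ∷ʳ x) q → PalOf (u ∷ʳ x) q

-- Write Pal(v) for the palindromic closure of v.  Justin's formula Pal(v a) = μ_v(a) Pal(v) makes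
-- Pal(v) a prefix of μ_v(a) Pal(v) for every letter a.  If a occurs in v, then Pal(v) has a
-- palindromic prefix t followed by a; reflecting it gives a palindrome of length 2|Pal(v)| − |t|
-- extending Pal(v) a, whence |μ_v(a)| ≤ |Pal(v)|.  So when Alph(v) = 𝒜, Pal(v) occurs in μ_v(w)
-- at every position |μ_v(w₀⋯w_{k−1})|, and consecutive occurrences leave no gap.
-- Conversely, if b does not occur in v, then μ_v(b) ends with b while μ_v(c) avoids b for c ≠ b,
-- so b occurs only once in μ_v(b c c c ⋯); in a quasiperiodic word every letter recurs.
-- Justin's formula itself is proved by induction on v from the definition of Pal: the palindromes
-- extending P a, for a palindrome P, are controlled by the palindromic prefixes t of P followed by a.

module Submission where

open import Defs
open import Data.Nat using (ℕ; zero; suc; _+_; _∸_; _≤_; _<_; z≤n; s≤s; _<?_)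
open import Data.Nat.Properties hiding (_≟_)
open import Algebra.Properties.CommutativeSemigroup +-commutativeSemigroup using (xy∙z≈xz∙y)
open import Data.Fin using (Fin; fromℕ<)
import Data.Fin as Fin
open import Data.Fin.Properties using (_≟_)
open import Data.Maybe using (Maybe; just; nothing)
open import Data.Maybe.Properties using (just-injective)
open import Data.List using (List; []; _∷_; [_]; _++_; length; reverse; _∷ʳ_; concatMap; lookup)
open import Data.List.Properties
  using (++-assoc; ++-identityʳ; ++-cancelˡ; ++-cancelʳ; length-++; reverse-++; length-reverse;
         reverse-involutive; reverse-injective; unfold-reverse; ∷-injective; ∷-injectiveʳ; ∷ʳ-++;
         ∷ʳ-injectiveʳ; concatMap-++; concatMap-pure; concatMap-cong)
open import Data.List.NonEmpty using (List⁺; _∷_; toList)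
open import Data.List.NonEmpty.Properties using (toList->>=)
open import Data.List.Relation.Unary.All as All using (All; []; _∷_)
open import Data.List.Relation.Unary.All.Properties using (concat⁺; map⁺)
open import Data.List.Relation.Unary.Any using (here; there)
open import Data.List.Membership.Propositional using (_∈_; _∉_)
open import Data.List.Membership.Propositional.Properties using (∈-++⁻)
import Data.List.Membership.DecPropositional as DecMembership
open import Data.List.Reverse using (Reverse; reverseView; []; _∶_∶ʳ_)
open import Data.Product using (∃; _×_; _,_; proj₁; proj₂)
open import Data.Sum using (_⊎_; inj₁; inj₂)
open import Data.Empty using (⊥-elim)
open import Function using (_∘_)
open import Function.Bundles using (_⇔_; mk⇔; Equivalence)
open import Relation.Nullary using (¬_; yes; no)
open import Relation.Binary.PropositionalEquality hiding ([_])

module _ {A : Set} where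

  -- On Word n these are IsPrefixW, IsPalindrome and ShortestPalWithPrefix.

  infix 4 _≼_

  _≼_ : List A → List A → Set
  u ≼ x = ∃ λ t → u ++ t ≡ x

  Palindrome : List A → Set
  Palindrome u = reverse u ≡ u

  ShortestPal : List A → List A → Set
  ShortestPal s q = Palindrome q × s ≼ q × (∀ r → Palindrome r → s ≼ r → length q ≤ length r)

  ≼-∷ʳ : ∀ (u : List A) a → u ≼ u ∷ʳ a
  ≼-∷ʳ u a = [ a ] , refl

  ≼-trans : ∀ {u v x : List A} → u ≼ v → v ≼ x → u ≼ x
  ≼-trans {u} (t , refl) (t′ , refl) = t ++ t′ , sym (++-assoc u t t′)

  ≼-++ˡ : ∀ (w : List A) {u v} → u ≼ v → w ++ u ≼ w ++ v
  ≼-++ˡ w {u} (t , refl) = t , ++-assoc w u t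

  ≼-++ʳ : ∀ {u v : List A} z → u ≼ v → u ≼ v ++ z
  ≼-++ʳ {u} z (t , refl) = t ++ z , sym (++-assoc u t z)

  ≼-length : ∀ {u x : List A} → u ≼ x → length u ≤ length x
  ≼-length {u} (t , refl) = subst (length u ≤_) (sym (length-++ u)) (m≤m+n _ _)

  common-prefix-≼ : ∀ {u u′ x : List A} → u ≼ x → u′ ≼ x → length u ≤ length u′ → u ≼ u′
  common-prefix-≼ {[]}    {u′}     _          _        _         = u′ , refl
  common-prefix-≼ {a ∷ u} {_ ∷ u′} (t , refl) (t′ , e) (s≤s le) with ∷-injective e
  ... | refl , e′ with common-prefix-≼ (t , refl) (t′ , e′) le
  ...   | m , u++m≡u′ = m , cong (a ∷_) u++m≡u′

  common-prefix-≡ : ∀ {u u′ x : List A} → u ≼ x → u′ ≼ x → length u ≡ length u′ → u ≡ u′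
  common-prefix-≡ {[]}    {[]}     _          _        _  = refl
  common-prefix-≡ {a ∷ u} {_ ∷ u′} (t , refl) (t′ , e) eq with ∷-injective e
  ... | refl , e′ = cong (a ∷_) (common-prefix-≡ (t , refl) (t′ , e′) (suc-injective eq))

  reverse-++-∷ : ∀ (t : List A) a m → reverse (t ++ a ∷ m) ≡ reverse m ++ a ∷ reverse t
  reverse-++-∷ t a m = begin
    reverse (t ++ a ∷ m)          ≡⟨ reverse-++ t (a ∷ m) ⟩
    reverse (a ∷ m) ++ reverse t  ≡⟨ cong (_++ reverse t) (unfold-reverse a m) ⟩
    reverse m ∷ʳ a ++ reverse t   ≡⟨ ∷ʳ-++ (reverse m) a (reverse t) ⟩
    reverse m ++ a ∷ reverse t    ∎
    where open ≡-Reasoning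

  palindrome-wrap : ∀ (w : List A) {q} → Palindrome q → Palindrome (w ++ q ++ reverse w)
  palindrome-wrap w {q} pal-q = begin
    reverse (w ++ q ++ reverse w)               ≡⟨ reverse-++ w (q ++ reverse w) ⟩
    reverse (q ++ reverse w) ++ reverse w       ≡⟨ cong (_++ reverse w) (reverse-++ q (reverse w)) ⟩
    (reverse (reverse w) ++ reverse q) ++ reverse w
      ≡⟨ cong₂ (λ x y → (x ++ y) ++ reverse w) (reverse-involutive w) pal-q ⟩
    (w ++ q) ++ reverse w                       ≡⟨ ++-assoc w q (reverse w) ⟩
    w ++ q ++ reverse w                         ∎
    where open ≡-Reasoning

  palindrome-++-∷ : ∀ {P : List A} a → Palindrome P → Palindrome (P ++ a ∷ P)
  palindrome-++-∷ {P} a pal-P = trans (reverse-++-∷ P a P) (cong (λ x → x ++ a ∷ x) pal-P)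

  palindrome-mirror : ∀ {P t m : List A} {a} → Palindrome P → P ≡ t ++ a ∷ m →
                      Palindrome t ⇔ Palindrome (P ++ a ∷ m)
  palindrome-mirror {P} {t} {m} {a} pal-P refl = mk⇔
    (λ pal-t → trans reversed (trans (cong (λ x → (reverse m ++ a ∷ x) ++ a ∷ m) (sym pal-t)) (sym mirrored)))
    (λ pal → sym (∷-injectiveʳ (++-cancelˡ (reverse m) _ _
               (++-cancelʳ (a ∷ m) _ _ (trans (sym reversed) (trans pal mirrored))))))
    where
    open ≡-Reasoning
    reversed : reverse (P ++ a ∷ m) ≡ (reverse m ++ a ∷ t) ++ a ∷ m
    reversed = begin
      reverse (P ++ a ∷ m)           ≡⟨ reverse-++-∷ P a m ⟩
      reverse m ++ a ∷ reverse P     ≡⟨ cong (λ x → reverse m ++ a ∷ x) pal-P ⟩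
      reverse m ++ a ∷ (t ++ a ∷ m)  ≡⟨ sym (++-assoc (reverse m) (a ∷ t) (a ∷ m)) ⟩
      (reverse m ++ a ∷ t) ++ a ∷ m  ∎
    mirrored : P ++ a ∷ m ≡ (reverse m ++ a ∷ reverse t) ++ a ∷ m
    mirrored = cong (_++ a ∷ m) (trans (sym pal-P) (reverse-++-∷ t a m))

  length-∷ʳ : ∀ (u : List A) a → length (u ∷ʳ a) ≡ suc (length u)
  length-∷ʳ u a = trans (length-++ u) (+-comm (length u) 1)

  mirror-length : ∀ {P t m : List A} {a} → P ≡ t ++ a ∷ m →
                  length (P ++ a ∷ m) + length t ≡ length P + length P
  mirror-length {P} {t} {m} {a} refl = begin
    length (P ++ a ∷ m) + length t          ≡⟨ cong (_+ length t) (length-++ P) ⟩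
    length P + suc (length m) + length t    ≡⟨ +-assoc (length P) _ _ ⟩
    length P + (suc (length m) + length t)  ≡⟨ cong (length P +_) (+-comm (suc (length m)) (length t)) ⟩
    length P + (length t + suc (length m))  ≡⟨ cong (length P +_) (sym (length-++ t)) ⟩
    length P + length P                     ∎
    where open ≡-Reasoning

  palindrome-reflect : ∀ {P t : List A} {a} → Palindrome P → Palindrome t → t ∷ʳ a ≼ P →
    ∃ λ r → Palindrome r × P ∷ʳ a ≼ r × length r + length t ≡ length P + length P
  palindrome-reflect {P} {t} {a} pal-P pal-t (m , t∷ʳa++m≡P) =
    P ++ a ∷ m , Equivalence.to (palindrome-mirror pal-P P≡) pal-t , (m , ∷ʳ-++ P a m) , mirror-length P≡
    where
    P≡ : P ≡ t ++ a ∷ m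
    P≡ = trans (sym t∷ʳa++m≡P) (∷ʳ-++ t a m)

  palindrome-split : ∀ {P e : List A} {a} → Palindrome P → Palindrome (P ++ a ∷ e) →
                     length e < length P → ∃ λ t → P ≡ t ++ a ∷ e
  palindrome-split {P} {e} {a} pal-P pal-r e<P = t , ++-cancelˡ e′ P (t ++ a ∷ e) (begin
      e′ ++ P                 ≡⟨ reversed ⟩
      P ++ a ∷ e              ≡⟨ cong (_++ a ∷ e) (sym e′++t≡P) ⟩
      (e′ ++ t) ++ a ∷ e      ≡⟨ ++-assoc e′ t (a ∷ e) ⟩
      e′ ++ t ++ a ∷ e        ∎)
    where
    open ≡-Reasoning
    e′ = reverse e ∷ʳ a
    reversed : e′ ++ P ≡ P ++ a ∷ e
    reversed = begin
      e′ ++ P                       ≡⟨ cong₂ _++_ (sym (unfold-reverse a e)) (sym pal-P) ⟩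
      reverse (a ∷ e) ++ reverse P  ≡⟨ sym (reverse-++ P (a ∷ e)) ⟩
      reverse (P ++ a ∷ e)          ≡⟨ pal-r ⟩
      P ++ a ∷ e                    ∎
    |e′|≤|P| : length e′ ≤ length P
    |e′|≤|P| = subst (_≤ length P) (sym (trans (length-∷ʳ (reverse e) a) (cong suc (length-reverse e)))) e<P
    e′≼P = common-prefix-≼ (P , reversed) (a ∷ e , refl) |e′|≤|P|
    t = proj₁ e′≼P
    e′++t≡P = proj₂ e′≼P

  palindrome-unreflect : ∀ {P r : List A} {a} → Palindrome P → Palindrome r → P ∷ʳ a ≼ r →
    length P + length P < length r
    ⊎ ∃ λ t → Palindrome t × t ∷ʳ a ≼ P × length r + length t ≡ length P + length P
  palindrome-unreflect {P} {_} {a} pal-P pal-r (e , refl) with length e <? length P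
  ... | no e≮P = inj₁ (subst (length P + length P <_) (sym |r|≡) (+-monoʳ-< (length P) (s≤s (≮⇒≥ e≮P))))
    where
    |r|≡ : length (P ∷ʳ a ++ e) ≡ length P + suc (length e)
    |r|≡ = trans (cong length (∷ʳ-++ P a e)) (length-++ P)
  ... | yes e<P = inj₂ (t , pal-t , (e , trans (∷ʳ-++ t a e) (sym P≡)) ,
                        trans (cong (λ r → length r + length t) r≡) (mirror-length P≡))
    where
    r≡ = ∷ʳ-++ P a e
    pal-P++a∷e = subst Palindrome r≡ pal-r
    split = palindrome-split pal-P pal-P++a∷e e<P
    t = proj₁ split
    P≡ = proj₂ split
    pal-t : Palindrome t
    pal-t = Equivalence.from (palindrome-mirror pal-P P≡) pal-P++a∷e

  reverse-suffix-≼ : ∀ (s e : List A) → Palindrome (s ++ e) → length (s ++ e) ≤ length s + length s →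
                     reverse e ≼ s
  reverse-suffix-≼ s e pal |s++e|≤ =
    common-prefix-≼ (reverse s , trans (sym (reverse-++ s e)) pal) (e , refl) |e′|≤|s|
    where
    |e′|≤|s| : length (reverse e) ≤ length s
    |e′|≤|s| = subst (_≤ length s) (sym (length-reverse e))
      (+-cancelˡ-≤ (length s) _ _ (subst (_≤ length s + length s) (length-++ s) |s++e|≤))

  palindromes-≡-by-length : ∀ {s q₁ q₂ : List A} → Palindrome q₁ → Palindrome q₂ → s ≼ q₁ → s ≼ q₂ →
    length q₁ ≡ length q₂ → length q₁ ≤ length s + length s → q₁ ≡ q₂
  palindromes-≡-by-length {s} pal₁ pal₂ (e₁ , refl) (e₂ , refl) |q₁|≡|q₂| |q₁|≤ =
    cong (s ++_) (reverse-injective (common-prefix-≡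
      (reverse-suffix-≼ s e₁ pal₁ |q₁|≤) (reverse-suffix-≼ s e₂ pal₂ (subst (_≤ _) |q₁|≡|q₂| |q₁|≤))
      (trans (length-reverse e₁) (trans |e₁|≡|e₂| (sym (length-reverse e₂))))))
    where
    |e₁|≡|e₂| : length e₁ ≡ length e₂
    |e₁|≡|e₂| = +-cancelˡ-≡ (length s) _ _ (trans (sym (length-++ s)) (trans |q₁|≡|q₂| (length-++ s)))

  ShortestPal-≤-double : ∀ {s q : List A} → ShortestPal s q → length q ≤ length s + length s
  ShortestPal-≤-double {s} (_ , _ , minimal) =
    subst (_ ≤_) (trans (length-++ s) (cong (length s +_) (length-reverse s)))
      (minimal (s ++ reverse s) (palindrome-wrap s {[]} refl) (reverse s , refl))

  ShortestPal-unique : ∀ {s q₁ q₂ : List A} → ShortestPal s q₁ → ShortestPal s q₂ → q₁ ≡ q₂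
  ShortestPal-unique sp₁@(pal₁ , s≼q₁ , min₁) (pal₂ , s≼q₂ , min₂) =
    palindromes-≡-by-length pal₁ pal₂ s≼q₁ s≼q₂
      (≤-antisym (min₁ _ pal₂ s≼q₂) (min₂ _ pal₁ s≼q₁)) (ShortestPal-≤-double sp₁)

  ShortestPal-≤-∷ʳ : ∀ {P q : List A} {a} → Palindrome P → ShortestPal (P ∷ʳ a) q →
                     length q ≤ suc (length P + length P)
  ShortestPal-≤-∷ʳ {P} {_} {a} pal-P (_ , _ , minimal) =
    subst (_ ≤_) (trans (length-++ P) (+-suc (length P) (length P)))
      (minimal (P ++ a ∷ P) (palindrome-++-∷ a pal-P) (P , ∷ʳ-++ P a P))

  ShortestPal-reflect : ∀ {P w t : List A} {a} → Palindrome P → ShortestPal (P ∷ʳ a) (w ++ P) →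
    Palindrome t → t ∷ʳ a ≼ P → length w + length t ≤ length P
  ShortestPal-reflect {P} {w} {t} pal-P (_ , _ , minimal) pal-t t∷ʳa≼P
    with palindrome-reflect pal-P pal-t t∷ʳa≼P
  ... | r , pal-r , P∷ʳa≼r , |r|+|t|≡ = +-cancelʳ-≤ (length P) _ _ (begin
    length w + length t + length P  ≡⟨ xy∙z≈xz∙y (length w) (length t) (length P) ⟩
    length w + length P + length t  ≡⟨ cong (_+ length t) (length-++ w) ⟨
    length (w ++ P) + length t      ≤⟨ +-monoˡ-≤ (length t) (minimal r pal-r P∷ʳa≼r) ⟩
    length r + length t             ≡⟨ |r|+|t|≡ ⟩
    length P + length P             ∎)
    where open ≤-Reasoning

  ShortestPal-palindromic-prefix : ∀ {s q t : List A} {c} → ShortestPal s q →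
    Palindrome t → t ∷ʳ c ≼ q → length t < length s
  ShortestPal-palindromic-prefix {s} {q} {t} {c} (_ , s≼q , minimal) pal-t t∷ʳc≼q = ≰⇒> λ |s|≤|t| →
    <-irrefl refl (≤-trans |t∷ʳc|≤|q| (minimal t pal-t (common-prefix-≼ s≼q t≼q |s|≤|t|)))
    where
    t≼q = ≼-trans (≼-∷ʳ t c) t∷ʳc≼q
    |t∷ʳc|≤|q| : suc (length t) ≤ length q
    |t∷ʳc|≤|q| = subst (_≤ length q) (length-∷ʳ t c) (≼-length t∷ʳc≼q)

  -- A palindrome extending P a is longer than 2|P|, or at least as long as the reflection
  -- P a m of a palindromic prefix t a m = P, which has length 2|P| − |t|.
  palindromic-extension-≥ : ∀ {P r : List A} {a N} → Palindrome P → N ≤ suc (length P + length P) →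
    (∀ t → Palindrome t → t ∷ʳ a ≼ P → N + length t ≤ length P + length P) →
    Palindrome r → P ∷ʳ a ≼ r → N ≤ length r
  palindromic-extension-≥ {N = N} pal-P N≤ reflected pal-r P∷ʳa≼r with palindrome-unreflect pal-P pal-r P∷ʳa≼r
  ... | inj₁ long = ≤-trans N≤ long
  ... | inj₂ (t , pal-t , t∷ʳa≼P , |r|+|t|≡) =
    +-cancelʳ-≤ (length t) N _ (subst (N + length t ≤_) (sym |r|+|t|≡) (reflected t pal-t t∷ʳa≼P))

increasing-brackets : ∀ (g : ℕ → ℕ) → (∀ k → g k < g (suc k)) → ∀ {m} → g 0 ≤ m →
                      ∃ λ k → g k ≤ m × m < g (suc k)
increasing-brackets g increasing {m} g0≤m = search (suc m) (n≤g (suc m))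
  where
  n≤g : ∀ k → k ≤ g k
  n≤g zero    = z≤n
  n≤g (suc k) = ≤-trans (s≤s (n≤g k)) (increasing k)
  search : ∀ k → m < g k → ∃ λ k → g k ≤ m × m < g (suc k)
  search zero    m<g0     = ⊥-elim (<⇒≱ m<g0 g0≤m)
  search (suc k) m<g[1+k] with m <? g k
  ... | yes m<gk = search k m<gk
  ... | no  m≮gk = k , ≮⇒≥ m≮gk , m<g[1+k]

module _ {A : Set} where

  _‼_ : List A → ℕ → Maybe A
  []       ‼ _     = nothing
  (x ∷ xs) ‼ zero  = just x
  (x ∷ xs) ‼ suc i = xs ‼ i

  ‼-++ˡ : ∀ (xs ys : List A) i → i < length xs → (xs ++ ys) ‼ i ≡ xs ‼ i
  ‼-++ˡ (x ∷ xs) ys zero    _       = refl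
  ‼-++ˡ (x ∷ xs) ys (suc i) (s≤s i<) = ‼-++ˡ xs ys i i<

  ‼-++ʳ : ∀ (xs ys : List A) j → (xs ++ ys) ‼ (length xs + j) ≡ ys ‼ j
  ‼-++ʳ []       ys j = refl
  ‼-++ʳ (x ∷ xs) ys j = ‼-++ʳ xs ys j

  ‼-∷ʳ : ∀ (xs : List A) x → (xs ∷ʳ x) ‼ length xs ≡ just x
  ‼-∷ʳ []       x = refl
  ‼-∷ʳ (_ ∷ xs) x = ‼-∷ʳ xs x

  ‼-lookup : ∀ (xs : List A) i (i< : i < length xs) → xs ‼ i ≡ just (lookup xs (fromℕ< i<))
  ‼-lookup (x ∷ xs) zero    _        = refl
  ‼-lookup (x ∷ xs) (suc i) (s≤s i<) = ‼-lookup xs i i<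

  -- u ⊑ w: u is a prefix of the infinite word w (Defs' IsPrefix, indexed by ℕ instead of Fin).

  infix 4 _⊑_

  _⊑_ : List A → (ℕ → A) → Set
  u ⊑ w = ∀ i → i < length u → u ‼ i ≡ just (w i)

  ≼-⊑ : ∀ {u x : List A} {w} → u ≼ x → x ⊑ w → u ⊑ w
  ≼-⊑ {u} (t , refl) x⊑w i i< =
    trans (sym (‼-++ˡ u t i i<)) (x⊑w i (≤-trans i< (≼-length {u = u} {x = u ++ t} (t , refl))))

  ⊑-++ʳ : ∀ {p u : List A} {w} → p ++ u ⊑ w → ∀ d → d < length u → u ‼ d ≡ just (w (length p + d))
  ⊑-++ʳ {p} {u} p++u⊑w d d< =
    trans (sym (‼-++ʳ p u d)) (p++u⊑w _ (subst (length p + d <_) (sym (length-++ p)) (+-monoʳ-< (length p) d<)))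

  drop∞ : ℕ → (ℕ → A) → (ℕ → A)
  drop∞ zero    w = w
  drop∞ (suc k) w = drop∞ k (λ i → w (suc i))

  0<length-toList : ∀ (l : List⁺ A) → 0 < length (toList l)
  0<length-toList (_ ∷ _) = s≤s z≤n

module _ {n : ℕ} where

  μ′ : Word n → Fin n → Word n
  μ′ v a = toList (μ v a)

  L′ : Fin n → Fin n → Word n
  L′ x a = toList (L x a)

  L′-self : ∀ x → L′ x x ≡ [ x ]
  L′-self x with x ≟ x
  ... | yes _   = refl
  ... | no x≢x = ⊥-elim (x≢x refl)

  L′-other : ∀ {x a} → x ≢ a → L′ x a ≡ x ∷ a ∷ []
  L′-other {x} {a} x≢a with x ≟ a
  ... | yes x≡a = ⊥-elim (x≢a x≡a)
  ... | no _    = refl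

  L′-ends-with : ∀ x a → ∃ λ k → L′ x a ≡ k ∷ʳ a
  L′-ends-with x a with x ≟ a
  ... | yes refl = [] , refl
  ... | no _     = [ x ] , refl

  μ′-∷ : ∀ y v a → μ′ (y ∷ v) a ≡ concatMap (L′ y) (μ′ v a)
  μ′-∷ y v a = sym (toList->>= (L y) (μ v a))

  concatMap-concatMap : ∀ (f g : Fin n → Word n) xs →
    concatMap g (concatMap f xs) ≡ concatMap (λ b → concatMap g (f b)) xs
  concatMap-concatMap f g [] = refl
  concatMap-concatMap f g (x ∷ xs) =
    trans (concatMap-++ g (f x) (concatMap f xs)) (cong (concatMap g (f x) ++_) (concatMap-concatMap f g xs))

  μ′-∷ʳ : ∀ v x a → μ′ (v ∷ʳ x) a ≡ concatMap (μ′ v) (L′ x a)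
  μ′-∷ʳ [] x a = trans (μ′-∷ x [] a) (trans (++-identityʳ (L′ x a)) (sym (concatMap-pure (L′ x a))))
  μ′-∷ʳ (y ∷ v) x a = begin
    μ′ (y ∷ v ∷ʳ x) a                                   ≡⟨ μ′-∷ y (v ∷ʳ x) a ⟩
    concatMap (L′ y) (μ′ (v ∷ʳ x) a)                    ≡⟨ cong (concatMap (L′ y)) (μ′-∷ʳ v x a) ⟩
    concatMap (L′ y) (concatMap (μ′ v) (L′ x a))        ≡⟨ concatMap-concatMap (μ′ v) (L′ y) (L′ x a) ⟩
    concatMap (λ b → concatMap (L′ y) (μ′ v b)) (L′ x a) ≡⟨ concatMap-cong (λ b → sym (μ′-∷ y v b)) (L′ x a) ⟩
    concatMap (μ′ (y ∷ v)) (L′ x a)                     ∎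
    where open ≡-Reasoning

  μ′-ends-with : ∀ v a → ∃ λ m → μ′ v a ≡ m ∷ʳ a
  μ′-ends-with []      a = [] , refl
  μ′-ends-with (y ∷ v) a with μ′-ends-with v a | L′-ends-with y a
  ... | m , μ′va≡ | k , L′ya≡ = concatMap (L′ y) m ++ k , (begin
    μ′ (y ∷ v) a                          ≡⟨ μ′-∷ y v a ⟩
    concatMap (L′ y) (μ′ v a)             ≡⟨ cong (concatMap (L′ y)) μ′va≡ ⟩
    concatMap (L′ y) (m ∷ʳ a)             ≡⟨ concatMap-++ (L′ y) m [ a ] ⟩
    concatMap (L′ y) m ++ L′ y a ++ []    ≡⟨ cong (concatMap (L′ y) m ++_) (trans (++-identityʳ (L′ y a)) L′ya≡) ⟩
    concatMap (L′ y) m ++ k ∷ʳ a          ≡⟨ sym (++-assoc (concatMap (L′ y) m) k [ a ]) ⟩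
    (concatMap (L′ y) m ++ k) ∷ʳ a        ∎)
    where open ≡-Reasoning

  μ′-avoids : ∀ {v b} c → b ∉ v → c ≢ b → All (_≢ b) (μ′ v c)
  μ′-avoids {[]}    c b∉v c≢b = c≢b ∷ []
  μ′-avoids {y ∷ v} {b} c b∉v c≢b = subst (All (_≢ b)) (sym (μ′-∷ y v c))
    (concat⁺ (map⁺ (All.map L′-avoids (μ′-avoids c (b∉v ∘ there) c≢b))))
    where
    y≢b : y ≢ b
    y≢b refl = b∉v (here refl)
    L′-avoids : ∀ {d} → d ≢ b → All (_≢ b) (L′ y d)
    L′-avoids {d} d≢b with y ≟ d
    ... | yes _ = y≢b ∷ []
    ... | no _  = y≢b ∷ d≢b ∷ []

-- The inductive step of Justin's formula Pal(u x a) = μ_{ux}(a) Pal(u x), with P = Pal(u), P′ = Pal(u x).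
module JustinStep {n} {u P P′ : Word n} {x : Fin n}
  (pal-P : Palindrome P) (IH : ∀ a → ShortestPal (P ∷ʳ a) (μ′ u a ++ P))
  (P′-shortest : ShortestPal (P ∷ʳ x) P′) where

  private
    Mx = μ′ u x
    pal-P′ = proj₁ P′-shortest

    P′≡Mx++P : P′ ≡ Mx ++ P
    P′≡Mx++P = ShortestPal-unique P′-shortest (IH x)

    P′≡P++Mx′ : P′ ≡ P ++ reverse Mx
    P′≡P++Mx′ = begin
      P′                      ≡⟨ pal-P′ ⟨
      reverse P′              ≡⟨ cong reverse P′≡Mx++P ⟩
      reverse (Mx ++ P)       ≡⟨ reverse-++ Mx P ⟩
      reverse P ++ reverse Mx ≡⟨ cong (_++ reverse Mx) pal-P ⟩
      P ++ reverse Mx         ∎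
      where open ≡-Reasoning

    |P′| : length P′ ≡ length Mx + length P
    |P′| = trans (cong length P′≡Mx++P) (length-++ Mx)

    P≼P′ : P ≼ P′
    P≼P′ = ≼-trans (≼-∷ʳ P x) (proj₁ (proj₂ P′-shortest))

    palindromic-prefix-≤ : ∀ {t c} → Palindrome t → t ∷ʳ c ≼ P′ → length t ≤ length P
    palindromic-prefix-≤ {t} pal-t t∷ʳc≼P′ =
      ≤-pred (subst (length t <_) (length-∷ʳ P x) (ShortestPal-palindromic-prefix P′-shortest pal-t t∷ʳc≼P′))

    bound-2|P′|+1 : ∀ {A} → A ≤ suc (length P) → length Mx + (A + length P′) ≤ suc (length P′ + length P′)
    bound-2|P′|+1 {A} A≤ rewrite |P′| = begin
      length Mx + (A + (length Mx + length P))            ≤⟨ +-monoʳ-≤ (length Mx) (+-monoˡ-≤ _ A≤) ⟩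
      length Mx + (suc (length P) + (length Mx + length P)) ≡⟨ +-suc (length Mx) _ ⟩
      suc (length Mx + (length P + (length Mx + length P))) ≡⟨ cong suc (+-assoc (length Mx) _ _) ⟨
      suc (length Mx + length P + (length Mx + length P))  ∎
      where open ≤-Reasoning

    bound-2|P′| : ∀ {A t} → A + t ≤ length P → length Mx + (A + length P′) + t ≤ length P′ + length P′
    bound-2|P′| {A} {t} A+t≤ rewrite |P′| = begin
      length Mx + (A + Q) + t    ≡⟨ +-assoc (length Mx) _ t ⟩
      length Mx + (A + Q + t)    ≡⟨ cong (length Mx +_) (xy∙z≈xz∙y A Q t) ⟩
      length Mx + (A + t + Q)    ≤⟨ +-monoʳ-≤ (length Mx) (+-monoˡ-≤ Q A+t≤) ⟩
      length Mx + (length P + Q) ≡⟨ +-assoc (length Mx) _ _ ⟨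
      Q + Q                      ∎
      where
      open ≤-Reasoning
      Q = length Mx + length P

    shortest-self : ShortestPal (P′ ∷ʳ x) (Mx ++ P′)
    shortest-self = pal , prefix , minimal
      where
      pal : Palindrome (Mx ++ P′)
      pal = subst Palindrome (cong (Mx ++_) (sym P′≡P++Mx′)) (palindrome-wrap Mx pal-P)
      prefix : P′ ∷ʳ x ≼ Mx ++ P′
      prefix with μ′-ends-with u x
      ... | m , Mx≡m∷ʳx = reverse m , (begin
        P′ ∷ʳ x ++ reverse m       ≡⟨ ∷ʳ-++ P′ x (reverse m) ⟩
        P′ ++ x ∷ reverse m        ≡⟨ cong (P′ ++_) (reverse-++ m [ x ]) ⟨
        P′ ++ reverse (m ∷ʳ x)     ≡⟨ cong₂ (λ p w → p ++ reverse w) pal-P′ Mx≡m∷ʳx ⟨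
        reverse P′ ++ reverse Mx   ≡⟨ reverse-++ Mx P′ ⟨
        reverse (Mx ++ P′)         ≡⟨ pal ⟩
        Mx ++ P′                   ∎)
        where open ≡-Reasoning
      minimal : ∀ r → Palindrome r → P′ ∷ʳ x ≼ r → length (Mx ++ P′) ≤ length r
      minimal r pal-r P′∷ʳx≼r = subst (_≤ length r) (sym (length-++ Mx))
        (palindromic-extension-≥ pal-P′ (bound-2|P′|+1 z≤n)
          (λ t pal-t t∷ʳx≼P′ → bound-2|P′| (palindromic-prefix-≤ pal-t t∷ʳx≼P′)) pal-r P′∷ʳx≼r)

    shortest-other : ∀ {a} → x ≢ a → ShortestPal (P′ ∷ʳ a) (Mx ++ μ′ u a ++ P′)
    shortest-other {a} x≢a = pal , prefix , minimal
      where
      Ma = μ′ u a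
      pal-Ma++P = proj₁ (IH a)
      P∷ʳa≼Ma++P = proj₁ (proj₂ (IH a))
      C≡ : Mx ++ Ma ++ P′ ≡ Mx ++ (Ma ++ P) ++ reverse Mx
      C≡ = cong (Mx ++_) (trans (cong (Ma ++_) P′≡P++Mx′) (sym (++-assoc Ma P (reverse Mx))))
      pal : Palindrome (Mx ++ Ma ++ P′)
      pal = subst Palindrome (sym C≡) (palindrome-wrap Mx pal-Ma++P)
      prefix : P′ ∷ʳ a ≼ Mx ++ Ma ++ P′
      prefix = subst₂ _≼_ (trans (sym (++-assoc Mx P [ a ])) (cong (_∷ʳ a) (sym P′≡Mx++P))) (sym C≡)
                 (≼-++ˡ Mx (≼-++ʳ (reverse Mx) P∷ʳa≼Ma++P))
      |Ma|≤ : length Ma ≤ suc (length P)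
      |Ma|≤ = +-cancelʳ-≤ (length P) _ _
        (subst (_≤ suc (length P + length P)) (length-++ Ma) (ShortestPal-≤-∷ʳ pal-P (IH a)))
      reflected : ∀ t → Palindrome t → t ∷ʳ a ≼ P′ → length Ma + length t ≤ length P
      reflected t pal-t t∷ʳa≼P′ = ShortestPal-reflect pal-P (IH a) pal-t t∷ʳa≼P
        where
        |t|≢|P| : length t ≢ length P
        |t|≢|P| |t|≡|P| = x≢a (∷ʳ-injectiveʳ P t (common-prefix-≡ (proj₁ (proj₂ P′-shortest)) t∷ʳa≼P′
          (trans (length-∷ʳ P x) (trans (cong suc (sym |t|≡|P|)) (sym (length-∷ʳ t a))))))
        t∷ʳa≼P : t ∷ʳ a ≼ P
        t∷ʳa≼P = common-prefix-≼ t∷ʳa≼P′ P≼P′ (subst (_≤ length P) (sym (length-∷ʳ t a))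
          (≤∧≢⇒< (palindromic-prefix-≤ pal-t t∷ʳa≼P′) |t|≢|P|))
      minimal : ∀ r → Palindrome r → P′ ∷ʳ a ≼ r → length (Mx ++ Ma ++ P′) ≤ length r
      minimal r pal-r P′∷ʳa≼r =
        subst (_≤ length r) (sym (trans (length-++ Mx) (cong (length Mx +_) (length-++ Ma))))
        (palindromic-extension-≥ pal-P′ (bound-2|P′|+1 |Ma|≤)
          (λ t pal-t t∷ʳa≼P′ → bound-2|P′| (reflected t pal-t t∷ʳa≼P′)) pal-r P′∷ʳa≼r)

  shortest-extension : ∀ a → ShortestPal (P′ ∷ʳ a) (μ′ (u ∷ʳ x) a ++ P′)
  shortest-extension a with x ≟ a
  ... | yes refl = subst (λ w → ShortestPal (P′ ∷ʳ x) (w ++ P′)) (sym μ′ux≡) shortest-self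
    where
    μ′ux≡ : μ′ (u ∷ʳ x) x ≡ Mx
    μ′ux≡ = trans (μ′-∷ʳ u x x) (trans (cong (concatMap (μ′ u)) (L′-self x)) (++-identityʳ Mx))
  ... | no x≢a = subst (ShortestPal (P′ ∷ʳ a))
    (trans (sym (++-assoc Mx (μ′ u a) P′)) (cong (_++ P′) (sym μ′ua≡))) (shortest-other x≢a)
    where
    μ′ua≡ : μ′ (u ∷ʳ x) a ≡ Mx ++ μ′ u a
    μ′ua≡ = trans (μ′-∷ʳ u x a)
      (trans (cong (concatMap (μ′ u)) (L′-other x≢a)) (cong (Mx ++_) (++-identityʳ (μ′ u a))))

module _ {n : ℕ} where

  justin : ∀ {v P : Word n} → PalOf v P → Palindrome P × (∀ a → ShortestPal (P ∷ʳ a) (μ′ v a ++ P))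
  justin pal-ε = refl , λ a → refl , ([] , refl) , λ { r _ (t , refl) → s≤s z≤n }
  justin (pal-snoc {u} x h P′-shortest) with justin h
  ... | pal-P , IH = proj₁ P′-shortest , JustinStep.shortest-extension {u = u} pal-P IH P′-shortest

  PalOf-exists : ∀ (v : Word n) → ∃ (PalOf v)
  PalOf-exists v = go (reverseView v)
    where
    go : ∀ {v} → Reverse v → ∃ (PalOf v)
    go []             = [] , pal-ε
    go (u ∶ u′ ∶ʳ x) with go u′
    ... | P , h = μ′ u x ++ P , pal-snoc x h (proj₂ (justin h) x)

  PalOf-palindromic-prefix : ∀ {v P : Word n} {a} → PalOf v P → a ∈ v →
                             ∃ λ t → Palindrome t × t ∷ʳ a ≼ P
  PalOf-palindromic-prefix (pal-snoc {u} {p} x h P′-shortest) a∈u∷ʳx with ∈-++⁻ u a∈u∷ʳx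
  ... | inj₁ a∈u with PalOf-palindromic-prefix h a∈u
  ...   | t , pal-t , t∷ʳa≼p = t , pal-t , ≼-trans t∷ʳa≼p (≼-trans (≼-∷ʳ p x) (proj₁ (proj₂ P′-shortest)))
  PalOf-palindromic-prefix (pal-snoc x h P′-shortest) _ | inj₂ (here refl) =
    _ , proj₁ (justin h) , proj₁ (proj₂ P′-shortest)

  μ′-length-≤-Pal : ∀ {v P : Word n} {a} → PalOf v P → a ∈ v → length (μ′ v a) ≤ length P
  μ′-length-≤-Pal {a = a} h a∈v with justin h | PalOf-palindromic-prefix h a∈v
  ... | pal-P , IH | t , pal-t , t∷ʳa≼P = ≤-trans (m≤m+n _ _) (ShortestPal-reflect pal-P (IH a) pal-t t∷ʳa≼P)

  Pal-≼-μ′ : ∀ {v P : Word n} → PalOf v P → ∀ a → P ≼ μ′ v a ++ P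
  Pal-≼-μ′ h a = ≼-trans (≼-∷ʳ _ a) (proj₁ (proj₂ (proj₂ (justin h) a)))

module _ {n : ℕ} where

  IsPrefix⇒⊑ : ∀ {u : Word n} {w} → IsPrefix u w → u ⊑ w
  IsPrefix⇒⊑ {u} u≤w i i< = trans (‼-lookup u i i<) (cong just (u≤w i i<))

  ⊑⇒IsPrefix : ∀ {u : Word n} {w} → u ⊑ w → IsPrefix u w
  ⊑⇒IsPrefix {u} u⊑w i i< = just-injective (trans (sym (‼-lookup u i i<)) (u⊑w i i<))

module _ {n : ℕ} (f : Morphism n) where

  at-⊑ : ∀ l s {u} → u ⊑ image f s → toList l ++ u ⊑ at f l s
  at-⊑ (x ∷ xs)     s _    zero    _        = refl
  at-⊑ (x ∷ [])     s u⊑ (suc i) (s≤s i<) = u⊑ i i<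
  at-⊑ (x ∷ y ∷ ys) s u⊑ (suc i) (s≤s i<) = at-⊑ (y ∷ ys) s u⊑ i i<

  at-shift : ∀ l s j → at f l s (length (toList l) + j) ≡ image f s j
  at-shift (x ∷ xs) s j = go x xs
    where
    go : ∀ x xs → at f (x ∷ xs) s (length (x ∷ xs) + j) ≡ image f s j
    go x []       = refl
    go x (y ∷ ys) = go y ys

  at-All : ∀ {P : Fin n → Set} l s → All P (toList l) → (∀ k → All P (toList (f (s k)))) →
           ∀ i → P (at f l s i)
  at-All (x ∷ xs)     s (px ∷ _)  _    zero    = px
  at-All (x ∷ [])     s _         f[s] (suc i) =
    at-All (f (s 0)) (λ k → s (suc k)) (f[s] 0) (λ k → f[s] (suc k)) i
  at-All (x ∷ y ∷ ys) s (_ ∷ pys) f[s] (suc i) = at-All (y ∷ ys) s pys f[s] i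

  -- blocks f k w = f(w₀⋯w_{k−1}): the prefixes p_k at which the quasiperiod occurs.
  blocks : ℕ → InfWord n → Word n
  blocks zero    w = []
  blocks (suc k) w = toList (f (w 0)) ++ blocks k (λ i → w (suc i))

  blocks-⊑ : ∀ k w {u} → u ⊑ image f (drop∞ k w) → blocks k w ++ u ⊑ image f w
  blocks-⊑ zero    w u⊑ = u⊑
  blocks-⊑ (suc k) w {u} u⊑ = subst (_⊑ image f w) (sym (++-assoc (toList (f (w 0))) _ u))
    (at-⊑ (f (w 0)) (λ i → w (suc i)) (blocks-⊑ k (λ i → w (suc i)) u⊑))

  blocks-∷ʳ : ∀ k w → blocks (suc k) w ≡ blocks k w ++ toList (f (w k))
  blocks-∷ʳ zero    w = ++-identityʳ _
  blocks-∷ʳ (suc k) w = trans (cong (toList (f (w 0)) ++_) (blocks-∷ʳ k (λ i → w (suc i))))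
                              (sym (++-assoc (toList (f (w 0))) _ _))

  length-blocks : ∀ k w → k ≤ length (blocks k w)
  length-blocks zero    w = z≤n
  length-blocks (suc k) w = subst (suc k ≤_) (sym (length-++ (toList (f (w 0)))))
    (+-mono-≤ (0<length-toList (f (w 0))) (length-blocks k (λ i → w (suc i))))

  blocks-≼ : ∀ {q} → (∀ a → q ≼ toList (f a) ++ q) → ∀ k w → q ≼ blocks k w ++ q
  blocks-≼ {q} q≼ zero    w = [] , ++-identityʳ q
  blocks-≼ {q} q≼ (suc k) w = ≼-trans (q≼ (w 0)) (subst (toList (f (w 0)) ++ q ≼_)
    (sym (++-assoc (toList (f (w 0))) _ q)) (≼-++ˡ (toList (f (w 0))) (blocks-≼ q≼ k (λ i → w (suc i)))))

  ⊑-image : ∀ {q} → (∀ a → q ≼ toList (f a) ++ q) → ∀ w → q ⊑ image f w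
  ⊑-image {q} q≼ w = ≼-⊑ q≼blocks blocks⊑
    where
    blocks⊑ : blocks (length q) w ⊑ image f w
    blocks⊑ = ≼-⊑ {u = blocks (length q) w} ([] , refl) (blocks-⊑ (length q) w {[]} λ _ ())
    q≼blocks : q ≼ blocks (length q) w
    q≼blocks = common-prefix-≼ (blocks-≼ q≼ (length q) w) (_ , refl) (length-blocks (length q) w)

  IsQuasiperiod-image : ∀ {q} → (∀ a → q ≼ toList (f a) ++ q) → (∀ a → length (toList (f a)) ≤ length q) →
                        ∀ w → IsQuasiperiod q (image f w)
  IsQuasiperiod-image {q} q≼ short w = (λ k → blocks k w) , refl , λ k →
      subst (length (blocks k w) <_) (sym (|blocks-suc| k)) (m<m+n _ (0<length-toList (f (w k))))
    , subst₂ _≤_ (sym (|blocks-suc| k)) (sym (length-++ (blocks k w))) (+-monoʳ-≤ _ (short (w k)))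
    , ⊑⇒IsPrefix {u = blocks k w ++ q} (blocks-⊑ k w (⊑-image q≼ (drop∞ k w)))
    where
    |blocks-suc| : ∀ k → length (blocks (suc k) w) ≡ length (blocks k w) + length (toList (f (w k)))
    |blocks-suc| k = trans (cong length (blocks-∷ʳ k w)) (length-++ (blocks k w))

IsQuasiperiod-recurrent : ∀ {n} {u : Word n} {w} → IsQuasiperiod u w → ∀ i → ∃ λ j → i < j × w j ≡ w i
IsQuasiperiod-recurrent {u = u} {w} (p , p0≡[] , steps) i
  with increasing-brackets (λ k → length (p k)) (λ k → proj₁ (steps k))
                           (subst (_≤ i) (sym (cong length p0≡[])) z≤n)
... | k , |pk|≤i , i<|pk+1| = length (p (suc k)) + d , ≤-trans i<|pk+1| (m≤m+n _ d) , just-injective recurrence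
  where
  d = i ∸ length (p k)
  d<|u| : d < length u
  d<|u| = +-cancelˡ-< (length (p k)) _ _ (begin-strict
    length (p k) + d   ≡⟨ m+[n∸m]≡n |pk|≤i ⟩
    i                  <⟨ i<|pk+1| ⟩
    length (p (suc k)) ≤⟨ proj₁ (proj₂ (steps k)) ⟩
    length (p k ++ u)  ≡⟨ length-++ (p k) ⟩
    length (p k) + length u ∎)
    where open ≤-Reasoning
  occurrence : ∀ k → u ‼ d ≡ just (w (length (p k) + d))
  occurrence k = ⊑-++ʳ {p = p k} {u} (IsPrefix⇒⊑ {u = p k ++ u} (proj₂ (proj₂ (steps k)))) d d<|u|
  recurrence : just (w (length (p (suc k)) + d)) ≡ just (w i)
  recurrence = begin
    just (w (length (p (suc k)) + d)) ≡⟨ occurrence (suc k) ⟨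
    u ‼ d                             ≡⟨ occurrence k ⟩
    just (w (length (p k) + d))       ≡⟨ cong (just ∘ w) (m+[n∸m]≡n |pk|≤i) ⟩
    just (w i)                        ∎
    where open ≡-Reasoning

bc^ω : ∀ {n} → Fin n → Fin n → InfWord n
bc^ω b c zero    = b
bc^ω b c (suc _) = c

module _ {n : ℕ} {v : Word n} {b c : Fin n} (b∉v : b ∉ v) (c≢b : c ≢ b) where

  image-bc^ω-not-quasiperiodic : ¬ Quasiperiodic (image (μ v) (bc^ω b c))
  image-bc^ω-not-quasiperiodic (u , quasiperiod) with μ′-ends-with v b
  ... | m , μ′vb≡m∷ʳb with IsQuasiperiod-recurrent quasiperiod (length m)
  ...   | j , m<j , img[j]≡img[m] =
    avoids-b (j ∸ length (μ′ v b)) (trans (cong img (m+[n∸m]≡n |μ′vb|≤j)) (trans img[j]≡img[m] img[m]≡b))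
    where
    img = image (μ v) (bc^ω b c)
    |μ′vb|≤j : length (μ′ v b) ≤ j
    |μ′vb|≤j = subst (_≤ j) (sym (trans (cong length μ′vb≡m∷ʳb) (length-∷ʳ m b))) m<j
    img[m]≡b : img (length m) ≡ b
    img[m]≡b = just-injective (trans (sym μ′vb‼m) (‼-∷ʳ m b))
      where
      μ′vb⊑img : μ′ v b ⊑ img
      μ′vb⊑img = ≼-⊑ {u = μ′ v b} ([] , refl) (at-⊑ (μ v) (μ v b) (λ _ → c) {[]} λ _ ())
      μ′vb‼m : (m ∷ʳ b) ‼ length m ≡ just (img (length m))
      μ′vb‼m = subst (λ x → x ‼ length m ≡ just (img (length m))) μ′vb≡m∷ʳb
        (μ′vb⊑img (length m) (subst (length m <_) (sym (trans (cong length μ′vb≡m∷ʳb) (length-∷ʳ m b))) ≤-refl))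
    avoids-b : ∀ j → img (length (μ′ v b) + j) ≢ b
    avoids-b j = subst (_≢ b) (sym (at-shift (μ v) (μ v b) (λ _ → c) j))
      (at-All (μ v) (μ v c) (λ _ → c) (μ′-avoids c b∉v c≢b) (λ _ → μ′-avoids c b∉v c≢b) j)

another-letter : ∀ {n} → 2 ≤ n → (b : Fin n) → ∃ λ c → c ≢ b
another-letter (s≤s (s≤s _)) Fin.zero    = Fin.suc Fin.zero , λ ()
another-letter (s≤s (s≤s _)) (Fin.suc _) = Fin.zero , λ ()

Pal-IsQuasiperiod : ∀ {n} {v q : Word n} → AlphIsAll v → PalOf v q → ∀ w → IsQuasiperiod q (image (μ v) w)
Pal-IsQuasiperiod {v = v} all h = IsQuasiperiod-image (μ v) (Pal-≼-μ′ h) (λ a → μ′-length-≤-Pal h (all a))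

theorem5p1 : (n : ℕ) → 2 ≤ n → (v : Word n) →
    (StronglyQuasiperiodic (μ v) ⇔ AlphIsAll v)
    × (AlphIsAll v → (w : InfWord n) → (q : Word n) → PalOf v q →
         IsQuasiperiod q (image (μ v) w))
theorem5p1 n 2≤n v = mk⇔ all-letters strongly-quasiperiodic , λ all w q h → Pal-IsQuasiperiod all h w
  where
  all-letters : StronglyQuasiperiodic (μ v) → AlphIsAll v
  all-letters sq b with DecMembership._∈?_ (_≟_ {n}) b v
  ... | yes b∈v = b∈v
  ... | no  b∉v with another-letter 2≤n b
  ...   | c , c≢b = ⊥-elim (image-bc^ω-not-quasiperiodic b∉v c≢b (sq (bc^ω b c)))
  strongly-quasiperiodic : AlphIsAll v → StronglyQuasiperiodic (μ v)
  strongly-quasiperiodic all w = let q , h = PalOf-exists v in q , Pal-IsQuasiperiod all h w
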